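{- Let $p$ be a prime and let $L:\mathbb{F}_p^3\rightarrow\mathbb{F}_p^2$ be the linear map $L(x,y,z)=(x+z,y+z)$. Let $A,B,C\subseteq\mathbb{F}_p$ with $|A|=|B|=|C|=k$ and $k>\frac{2p}{3}$. Then $|L(A,B,C)|=p^2$, i.e., $L(A,B,C)=\mathbb{F}_p^2$.
   Context: $L(A,B,C)$ denotes the image of $A\times B\times C$ under $L$. -}

module Defs where

open import Data.Nat using (ℕ; NonZero; _+_)
open import Data.Nat.DivMod using (_mod_)
open import Data.Fin using (Fin; toℕ)
open import Data.Fin.Subset using (Subset; _∈_)
open import Data.Product using (_×_; _,_; ∃; ∃-syntax)
open import Relation.Binary.PropositionalEquality using (_≡_)

_+ₚ_ : ∀ {p} .{{_ : NonZero p}} → Fin p → Fin p → Fin p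
_+ₚ_ {p} a b = (toℕ a + toℕ b) mod p

L : ∀ {p} .{{_ : NonZero p}} → Fin p → Fin p → Fin p → Fin p × Fin p
L x y z = (x +ₚ z , y +ₚ z)

InImage : ∀ {p} .{{_ : NonZero p}} → Subset p → Subset p → Subset p → Fin p × Fin p → Set
InImage A B C w = ∃[ x ] ∃[ y ] ∃[ z ] (x ∈ A × y ∈ B × z ∈ C × L x y z ≡ w)

-- Given (u , v), look for z ∈ C with u − z ∈ A and v − z ∈ B, i.e. a point common to
-- C and the reflections u − A and v − B.  These three sets have k elements each and
-- 3k > 2p, so their indicator functions sum to more than 2p over F_p, and some z is
-- counted three times.
module Submission where

open import Defs
open import Data.Nat using (ℕ; suc; _*_; _<_; _≤_; _+_; _∸_; _%_; NonZero; s≤s; _≤?_)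
open import Data.Nat.Properties
open import Data.Nat.DivMod using (_mod_; %-distribˡ-+; m%n%n≡m%n; m<n⇒m%n≡m; [m+n]%n≡m%n)
open import Data.Nat.Primality using (Prime; prime⇒nonZero)
open import Data.Fin using (Fin; toℕ) renaming (zero to fzero; suc to fsuc)
open import Data.Fin.Properties using (toℕ-injective; toℕ<n; toℕ-fromℕ<)
open import Data.Fin.Subset using (Subset; ∣_∣; Side; inside; outside)
open import Data.Fin.Permutation using (Permutation′; permutation)
open import Data.Vec using ([]; _∷_; lookup)
open import Data.Vec.Properties using (lookup⇒[]=)
open import Data.Product using (_×_; _,_; ∃)
open import Algebra.Properties.CommutativeMonoid.Sum +-0-commutativeMonoid using (sum; ∑-permute; ∑-distrib-+)
open import Relation.Nullary using (yes; no)
open import Function using (_∘_)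
open import Relation.Binary.PropositionalEquality
open ≡-Reasoning

module ModularArithmetic {p : ℕ} .{{_ : NonZero p}} where

  %-absorbˡ : ∀ m n → (m % p + n) % p ≡ (m + n) % p
  %-absorbˡ m n = begin
    (m % p + n) % p           ≡⟨ %-distribˡ-+ (m % p) n p ⟩
    (m % p % p + n % p) % p   ≡⟨ cong (λ t → (t + n % p) % p) (m%n%n≡m%n m p) ⟩
    (m % p + n % p) % p       ≡⟨ %-distribˡ-+ m n p ⟨
    (m + n) % p               ∎

  +-∸-%-cancelʳ : ∀ m n → n ≤ p → (m + n + (p ∸ n)) % p ≡ m % p
  +-∸-%-cancelʳ m n n≤p = begin
    (m + n + (p ∸ n)) % p     ≡⟨ cong (_% p) (+-assoc m n (p ∸ n)) ⟩
    (m + (n + (p ∸ n))) % p   ≡⟨ cong (λ t → (m + t) % p) (m+[n∸m]≡n n≤p) ⟩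
    (m + p) % p               ≡⟨ [m+n]%n≡m%n m p ⟩
    m % p                     ∎

  toℕ-+ₚ : ∀ (x y : Fin p) → toℕ (x +ₚ y) ≡ (toℕ x + toℕ y) % p
  toℕ-+ₚ x y = toℕ-fromℕ< _

  +ₚ-comm : ∀ (x y : Fin p) → x +ₚ y ≡ y +ₚ x
  +ₚ-comm x y = cong (_mod p) (+-comm (toℕ x) (toℕ y))

  +ₚ-then-∸-% : ∀ (x z : Fin p) → (toℕ (x +ₚ z) + (p ∸ toℕ z)) % p ≡ toℕ x
  +ₚ-then-∸-% x z = begin
    (toℕ (x +ₚ z) + (p ∸ toℕ z)) % p       ≡⟨ cong (λ t → (t + (p ∸ toℕ z)) % p) (toℕ-+ₚ x z) ⟩
    ((toℕ x + toℕ z) % p + (p ∸ toℕ z)) % p ≡⟨ %-absorbˡ (toℕ x + toℕ z) (p ∸ toℕ z) ⟩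
    (toℕ x + toℕ z + (p ∸ toℕ z)) % p      ≡⟨ +-∸-%-cancelʳ (toℕ x) (toℕ z) (<⇒≤ (toℕ<n z)) ⟩
    toℕ x % p                              ≡⟨ m<n⇒m%n≡m (toℕ<n x) ⟩
    toℕ x                                  ∎

  +ₚ-cancelʳ : ∀ (x y z : Fin p) → x +ₚ z ≡ y +ₚ z → x ≡ y
  +ₚ-cancelʳ x y z eq = toℕ-injective (begin
    toℕ x                              ≡⟨ +ₚ-then-∸-% x z ⟨
    (toℕ (x +ₚ z) + (p ∸ toℕ z)) % p   ≡⟨ cong (λ w → (toℕ w + (p ∸ toℕ z)) % p) eq ⟩
    (toℕ (y +ₚ z) + (p ∸ toℕ z)) % p   ≡⟨ +ₚ-then-∸-% y z ⟩
    toℕ y                              ∎)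

  -- Representatives lie below p, so the truncated p ∸ toℕ z is an additive inverse of z modulo p.
  _-ₚ_ : Fin p → Fin p → Fin p
  x -ₚ z = (toℕ x + (p ∸ toℕ z)) mod p

  -ₚ-+ₚ : ∀ (x z : Fin p) → (x -ₚ z) +ₚ z ≡ x
  -ₚ-+ₚ x z = toℕ-injective (begin
    toℕ ((x -ₚ z) +ₚ z)                          ≡⟨ toℕ-+ₚ (x -ₚ z) z ⟩
    (toℕ (x -ₚ z) + toℕ z) % p                   ≡⟨ cong (λ t → (t + toℕ z) % p) (toℕ-fromℕ< _) ⟩
    ((toℕ x + (p ∸ toℕ z)) % p + toℕ z) % p      ≡⟨ %-absorbˡ (toℕ x + (p ∸ toℕ z)) (toℕ z) ⟩
    (toℕ x + (p ∸ toℕ z) + toℕ z) % p            ≡⟨ cong (_% p) (+-assoc (toℕ x) _ _) ⟩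
    (toℕ x + (p ∸ toℕ z + toℕ z)) % p            ≡⟨ cong (λ t → (toℕ x + t) % p) (m∸n+n≡m (<⇒≤ (toℕ<n z))) ⟩
    (toℕ x + p) % p                              ≡⟨ [m+n]%n≡m%n (toℕ x) p ⟩
    toℕ x % p                                    ≡⟨ m<n⇒m%n≡m (toℕ<n x) ⟩
    toℕ x                                        ∎)

  -ₚ-involutive : ∀ (x z : Fin p) → x -ₚ (x -ₚ z) ≡ z
  -ₚ-involutive x z = +ₚ-cancelʳ _ z (x -ₚ z) (begin
    (x -ₚ (x -ₚ z)) +ₚ (x -ₚ z)   ≡⟨ -ₚ-+ₚ x (x -ₚ z) ⟩
    x                             ≡⟨ -ₚ-+ₚ x z ⟨
    (x -ₚ z) +ₚ z                 ≡⟨ +ₚ-comm (x -ₚ z) z ⟩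
    z +ₚ (x -ₚ z)                 ∎)

  reflection : Fin p → Permutation′ p
  reflection x = permutation (x -ₚ_) (x -ₚ_) (-ₚ-involutive x) (-ₚ-involutive x)

open ModularArithmetic using (_-ₚ_; -ₚ-+ₚ; reflection)

𝟙 : Side → ℕ
𝟙 inside  = 1
𝟙 outside = 0

∣S∣≡∑𝟙 : ∀ {n} (S : Subset n) → ∣ S ∣ ≡ sum (λ i → 𝟙 (lookup S i))
∣S∣≡∑𝟙 []            = refl
∣S∣≡∑𝟙 (inside ∷ S)  = cong suc (∣S∣≡∑𝟙 S)
∣S∣≡∑𝟙 (outside ∷ S) = ∣S∣≡∑𝟙 S

∣S∣≡∑𝟙-reflected : ∀ {p} .{{_ : NonZero p}} (S : Subset p) (x : Fin p) →
                   ∣ S ∣ ≡ sum (λ z → 𝟙 (lookup S (x -ₚ z)))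
∣S∣≡∑𝟙-reflected S x = trans (∣S∣≡∑𝟙 S) (∑-permute (λ i → 𝟙 (lookup S i)) (reflection x))

∑>n*m⇒∃>m : ∀ m n (f : Fin n → ℕ) → n * m < sum f → ∃ λ i → m < f i
∑>n*m⇒∃>m m (suc n) f n*m<∑f with f fzero ≤? m
... | no  f0≰m = fzero , ≰⇒> f0≰m
... | yes f0≤m = let i , m<fi = ∑>n*m⇒∃>m m n (f ∘ fsuc) tail-bound in fsuc i , m<fi
  where
  tail-bound : n * m < sum (f ∘ fsuc)
  tail-bound = +-cancelˡ-< m (n * m) _ (<-≤-trans n*m<∑f (+-monoˡ-≤ _ f0≤m))

𝟙-sum>2⇒inside : ∀ a b c → 2 < 𝟙 a + 𝟙 b + 𝟙 c → a ≡ inside × b ≡ inside × c ≡ inside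
𝟙-sum>2⇒inside inside  inside  inside  _                = refl , refl , refl
𝟙-sum>2⇒inside inside  inside  outside (s≤s (s≤s ()))
𝟙-sum>2⇒inside inside  outside inside  (s≤s (s≤s ()))
𝟙-sum>2⇒inside outside inside  inside  (s≤s (s≤s ()))
𝟙-sum>2⇒inside inside  outside outside (s≤s ())
𝟙-sum>2⇒inside outside inside  outside (s≤s ())
𝟙-sum>2⇒inside outside outside inside  (s≤s ())
𝟙-sum>2⇒inside outside outside outside ()

multiplicity : ∀ {p} .{{_ : NonZero p}} → Subset p → Subset p → Subset p → Fin p → Fin p → Fin p → ℕ
multiplicity A B C x y z = 𝟙 (lookup A (x -ₚ z)) + 𝟙 (lookup B (y -ₚ z)) + 𝟙 (lookup C z)

∑multiplicity≡∣A∣+∣B∣+∣C∣ : ∀ {p} .{{_ : NonZero p}} (A B C : Subset p) (x y : Fin p) →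
                           sum (multiplicity A B C x y) ≡ ∣ A ∣ + ∣ B ∣ + ∣ C ∣
∑multiplicity≡∣A∣+∣B∣+∣C∣ A B C x y = begin
  sum (multiplicity A B C x y)
    ≡⟨ ∑-distrib-+ (λ z → 𝟙 (lookup A (x -ₚ z)) + 𝟙 (lookup B (y -ₚ z))) (λ z → 𝟙 (lookup C z)) ⟩
  sum (λ z → 𝟙 (lookup A (x -ₚ z)) + 𝟙 (lookup B (y -ₚ z))) + sum (λ z → 𝟙 (lookup C z))
    ≡⟨ cong (_+ sum (λ z → 𝟙 (lookup C z))) (∑-distrib-+ (λ z → 𝟙 (lookup A (x -ₚ z))) (λ z → 𝟙 (lookup B (y -ₚ z)))) ⟩
  sum (λ z → 𝟙 (lookup A (x -ₚ z))) + sum (λ z → 𝟙 (lookup B (y -ₚ z))) + sum (λ z → 𝟙 (lookup C z))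
    ≡⟨ cong₂ _+_ (cong₂ _+_ (∣S∣≡∑𝟙-reflected A x) (∣S∣≡∑𝟙-reflected B y)) (∣S∣≡∑𝟙 C) ⟨
  ∣ A ∣ + ∣ B ∣ + ∣ C ∣
    ∎

corollary1 : (p : ℕ) → (pr : Prime p) → (k : ℕ) → (A B C : Subset p) →
    ∣ A ∣ ≡ k → ∣ B ∣ ≡ k → ∣ C ∣ ≡ k → 2 * p < 3 * k →
    (u v : Fin p) → InImage {{prime⇒nonZero pr}} A B C (u , v)
corollary1 p pr k A B C ∣A∣≡k ∣B∣≡k ∣C∣≡k 2p<3k u v =
  let z , 2<mz              = ∑>n*m⇒∃>m 2 p (multiplicity A B C u v) p*2<∑m
      A∋u-z , B∋v-z , C∋z = 𝟙-sum>2⇒inside _ _ _ 2<mz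
  in  u -ₚ z , v -ₚ z , z
    , lookup⇒[]= _ A A∋u-z , lookup⇒[]= _ B B∋v-z , lookup⇒[]= _ C C∋z
    , cong₂ _,_ (-ₚ-+ₚ u z) (-ₚ-+ₚ v z)
  where
  instance
    p≢0 : NonZero p
    p≢0 = prime⇒nonZero pr

  ∑m≡3k : sum (multiplicity A B C u v) ≡ 3 * k
  ∑m≡3k = begin
    sum (multiplicity A B C u v) ≡⟨ ∑multiplicity≡∣A∣+∣B∣+∣C∣ A B C u v ⟩
    ∣ A ∣ + ∣ B ∣ + ∣ C ∣        ≡⟨ cong₂ _+_ (cong₂ _+_ ∣A∣≡k ∣B∣≡k) ∣C∣≡k ⟩
    k + k + k                    ≡⟨ cong (k + k +_) (+-identityʳ k) ⟨
    k + k + (k + 0)              ≡⟨ +-assoc k k (k + 0) ⟩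
    3 * k                        ∎

  p*2<∑m : p * 2 < sum (multiplicity A B C u v)
  p*2<∑m = subst₂ _<_ (*-comm 2 p) (sym ∑m≡3k) 2p<3k
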